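{- Let $G$ be a finite simple graph and let $q \ge p \ge 0$ be integers. Then $\alpha_q(G) \le \left\lceil \frac{q+1}{p+1} \right\rceil \alpha_p(G)$.
   Context: For an integer $k \ge 0$, a $k$-independent set of a graph $G=(V,E)$ is a set $S \subseteq V$ such that the subgraph induced by $S$ has maximum degree at most $k$. $\alpha_k(G)$ denotes the maximum cardinality of a $k$-independent set of $G$ (so $\alpha_0(G)$ is the usual independence number). -}

module Defs where

open import Data.Nat using (ℕ; suc; _+_; _*_; _≤_)
open import Data.Nat.DivMod using (_/_)
open import Data.Fin using (Fin)
open import Data.Fin.Subset using (Subset; _∈_; ∣_∣)
open import Data.Product using (Σ; _×_)
open import Data.Bool using (Bool; false; _∧_; T?)
open import Data.Vec using (count; allFin)
open import Data.Fin.Subset.Properties using (_∈?_)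
open import Relation.Nullary using (does)
open import Relation.Binary.PropositionalEquality using (_≡_)

record Graph (n : ℕ) : Set where
  field
    adj    : Fin n → Fin n → Bool
    sym    : ∀ u v → adj u v ≡ adj v u
    irrefl : ∀ u → adj u u ≡ false

open Graph public

degIn : {n : ℕ} → Graph n → Subset n → Fin n → ℕ
degIn {n} G S u = count (λ v → T? (adj G u v ∧ is∈ v)) (allFin n)
  where
  is∈ : Fin n → Bool
  is∈ v = does (v ∈? S)

IsKIndependent : {n : ℕ} → ℕ → Graph n → Subset n → Set
IsKIndependent {n} k G S = ∀ (u : Fin n) → u ∈ S → degIn G S u ≤ k

IsAlpha : {n : ℕ} → ℕ → Graph n → ℕ → Set
IsAlpha {n} k G m =
  Σ (Subset n) (λ S → IsKIndependent k G S × ∣ S ∣ ≡ m)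
  × (∀ (S : Subset n) → IsKIndependent k G S → ∣ S ∣ ≤ m)

-- ⌈ a / b ⌉ for b ≥ 1, written as ⌈ a / suc b' ⌉ = (a + b') / suc b'
ceilDiv : ℕ → ℕ → ℕ
ceilDiv a b' = (a + b') / suc b'

-- Partition a maximum q-independent set S into c = ⌈(q+1)/(p+1)⌉ colour classes
-- and recolour greedily so as to reduce the number of monochromatic edges. If a
-- vertex w of S has more than p neighbours in its own class, then, since it has at
-- most q < c(p+1) neighbours in S, some class receives at most p of them, and moving
-- w there strictly reduces the number of monochromatic edges. The process stops at
-- a colouring whose classes are all p-independent, so |S| ≤ c·α_p(G).
module Submission where

open import Defs hiding (sym)
open import Data.Nat using (ℕ; zero; suc; _+_; _*_; _≤_; _<_; z≤n; _<?_; _≤?_)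
open import Data.Nat.Properties hiding (_≟_)
open import Data.Nat.DivMod using (_%_; m≡m%n+[m/n]*n; m%n<n)
open import Data.Nat.Induction using (<-wellFounded)
open import Algebra.Properties.CommutativeSemigroup +-commutativeSemigroup using (xy∙z≈zy∙x)
open import Algebra.Properties.CommutativeMonoid.Sum +-0-commutativeMonoid
  using (sum; sum-remove; sum-cong-≗; sum-replicate-zero; ∑-distrib-+; ∑-comm)
open import Data.Fin using (Fin; zero; suc; punchIn)
open import Data.Fin.Properties using (_≟_; punchInᵢ≢i; all?; ¬∀⟶∃¬)
open import Data.Fin.Subset using (Subset; _∈_; _∉_; ∣_∣)
open import Data.Fin.Subset.Properties using (_∈?_)
open import Data.Vec using ([]; _∷_; tabulate; count)
open import Data.Vec.Functional using (updateAt)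
open import Data.Vec.Functional.Properties using (updateAt-updates; updateAt-minimal)
open import Data.Bool using (Bool; true; false; _∧_; if_then_else_; T?)
open import Data.Bool.Properties using (∧-assoc; ∧-zeroʳ; ∧-identityʳ; ∧-conicalˡ; ∧-conicalʳ)
open import Data.Empty using (⊥-elim)
open import Data.Product using (Σ; _,_)
open import Data.Sum using (_⊎_; inj₁; inj₂)
open import Function using (_∘_; id; const)
open import Induction.WellFounded using (Acc; acc)
open import Relation.Nullary using (does; yes; no)
open import Relation.Nullary.Decidable using (dec-true; dec-false; decidable-stable)
open import Relation.Binary.PropositionalEquality

sum-mono-≤ : ∀ {n} {f g : Fin n → ℕ} → (∀ i → f i ≤ g i) → sum f ≤ sum g
sum-mono-≤ {zero}  _   = z≤n
sum-mono-≤ {suc n} f≤g = +-mono-≤ (f≤g zero) (sum-mono-≤ (f≤g ∘ suc))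

sum-const : ∀ n a → sum {n} (const a) ≡ n * a
sum-const zero    a = refl
sum-const (suc n) a = cong (a +_) (sum-const n a)

sum-exchange : ∀ {n} (f g : Fin n → ℕ) (w : Fin n) → (∀ v → v ≢ w → f v ≡ g v) →
               sum f + g w ≡ sum g + f w
sum-exchange {suc n} f g w f≡g = begin
  sum f + g w                       ≡⟨ cong (_+ g w) (sum-remove {i = w} f) ⟩
  f w + sum (f ∘ punchIn w) + g w   ≡⟨ cong (λ s → f w + s + g w) (sum-cong-≗ λ i → f≡g _ (punchInᵢ≢i w i)) ⟩
  f w + sum (g ∘ punchIn w) + g w   ≡⟨ xy∙z≈zy∙x (f w) _ (g w) ⟩
  g w + sum (g ∘ punchIn w) + f w   ≡⟨ cong (_+ f w) (sum-remove {i = w} g) ⟨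
  sum g + f w                       ∎
  where open ≡-Reasoning

sum-single : ∀ {n} (f : Fin n → ℕ) (x : Fin n) → (∀ i → i ≢ x → f i ≡ 0) → sum f ≡ f x
sum-single {n} f x vanish = begin
  sum f                   ≡⟨ +-identityʳ (sum f) ⟨
  sum f + 0               ≡⟨ sum-exchange f (const 0) x vanish ⟩
  sum {n} (const 0) + f x ≡⟨ cong (_+ f x) (sum-replicate-zero n) ⟩
  f x                     ∎
  where open ≡-Reasoning

-- Symmetric arrays that differ only in row and column w have totals differing by
-- twice the difference of their rows w; stated additively to avoid truncated subtraction.
double-sum-exchange : ∀ {n} (E E′ : Fin n → Fin n → ℕ) (w : Fin n) →
  (∀ u v → u ≢ w → v ≢ w → E′ u v ≡ E u v) →
  (∀ u → E u w ≡ E w u) → (∀ u → E′ u w ≡ E′ w u) → E w w ≡ E′ w w →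
  sum (sum ∘ E′) + sum (E w) + sum (E w) ≡ sum (sum ∘ E) + sum (E′ w) + sum (E′ w)
double-sum-exchange E E′ w agree E-sym E′-sym diag = +-cancelʳ-≡ (E w w) _ _ (begin
  sum (sum ∘ E′) + sum (E w) + sum (E w) + E w w
    ≡⟨ +-assoc (sum (sum ∘ E′) + sum (E w)) (sum (E w)) (E w w) ⟩
  sum (sum ∘ E′) + sum (E w) + (sum (E w) + E w w)
    ≡⟨ cong₂ (λ s d → s + (sum (E w) + d)) (rowsWithColumn E′ E E-sym) (sym diag) ⟨
  sum (λ u → sum (E′ u) + E u w) + (sum (E w) + E′ w w)
    ≡⟨ sum-exchange (λ u → sum (E′ u) + E u w) (λ u → sum (E u) + E′ u w) w
         (λ u u≢w → sum-exchange (E′ u) (E u) w λ v v≢w → agree u v u≢w v≢w) ⟩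
  sum (λ u → sum (E u) + E′ u w) + (sum (E′ w) + E w w)
    ≡⟨ cong (_+ (sum (E′ w) + E w w)) (rowsWithColumn E E′ E′-sym) ⟩
  sum (sum ∘ E) + sum (E′ w) + (sum (E′ w) + E w w)
    ≡⟨ +-assoc (sum (sum ∘ E) + sum (E′ w)) (sum (E′ w)) (E w w) ⟨
  sum (sum ∘ E) + sum (E′ w) + sum (E′ w) + E w w ∎)
  where
  open ≡-Reasoning
  rowsWithColumn : ∀ F H → (∀ u → H u w ≡ H w u) →
                   sum (λ u → sum (F u) + H u w) ≡ sum (sum ∘ F) + sum (H w)
  rowsWithColumn F H H-sym = trans (∑-distrib-+ (sum ∘ F) (λ u → H u w))
                                   (cong (sum (sum ∘ F) +_) (sum-cong-≗ H-sym))

<-of-exchange : ∀ {a b x y} → a + x + x ≡ b + y + y → y < x → a < b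
<-of-exchange eq y<x = ≰⇒> λ b≤a → <-irrefl (sym eq) (+-mono-< (+-mono-≤-< b≤a y<x) y<x)

pigeonhole : ∀ {c} p (N : Fin c → ℕ) → sum N < c * suc p → Σ (Fin c) λ j → N j ≤ p
pigeonhole {c} p N small with all? (λ i → p <? N i)
... | yes allLarge = ⊥-elim (<⇒≱ small (begin
  c * suc p              ≡⟨ sum-const c (suc p) ⟨
  sum {c} (const (suc p)) ≤⟨ sum-mono-≤ allLarge ⟩
  sum N                  ∎))
  where open ≤-Reasoning
... | no notAllLarge with (j , notLarge) ← ¬∀⟶∃¬ c _ (λ i → p <? N i) notAllLarge = j , ≮⇒≥ notLarge

descend : ∀ {a ℓ} {A : Set a} {P : A → Set ℓ} (Φ : A → ℕ) →
          (∀ x → P x ⊎ Σ A (λ y → Φ y < Φ x)) → A → Σ A P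
descend {A = A} {P} Φ step x = go x (<-wellFounded (Φ x))
  where
  go : ∀ x → Acc _<_ (Φ x) → Σ A P
  go x (acc smaller) with step x
  ... | inj₁ Px       = x , Px
  ... | inj₂ (y , lt) = go y (smaller lt)

𝟙 : Bool → ℕ
𝟙 b = if b then 1 else 0

_∈ᵇ_ : ∀ {n} → Fin n → Subset n → Bool
v ∈ᵇ p = does (v ∈? p)

count-tabulate : ∀ {a} {A : Set a} {n} (b : A → Bool) (g : Fin n → A) →
                 count (T? ∘ b) (tabulate g) ≡ sum (𝟙 ∘ b ∘ g)
count-tabulate {n = zero}  b g = refl
count-tabulate {n = suc n} b g with b (g zero)
... | true  = cong suc (count-tabulate b (g ∘ suc))
... | false = count-tabulate b (g ∘ suc)

∣∣≡sum : ∀ {n} (p : Subset n) → ∣ p ∣ ≡ sum (λ v → 𝟙 (v ∈ᵇ p))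
∣∣≡sum []          = refl
∣∣≡sum (true ∷ p)  = cong suc (∣∣≡sum p)
∣∣≡sum (false ∷ p) = ∣∣≡sum p

∈ᵇ-tabulate : ∀ {n} (f : Fin n → Bool) v → v ∈ᵇ tabulate f ≡ f v
∈ᵇ-tabulate f zero with f zero
... | true  = refl
... | false = refl
∈ᵇ-tabulate f (suc v) = ∈ᵇ-tabulate (f ∘ suc) v

degIn≡sum : ∀ {n} (G : Graph n) T u → degIn G T u ≡ sum (λ v → 𝟙 (adj G u v ∧ v ∈ᵇ T))
degIn≡sum G T u = count-tabulate (λ v → adj G u v ∧ v ∈ᵇ T) id

does-≟-sym : ∀ {c} (i j : Fin c) → does (i ≟ j) ≡ does (j ≟ i)
does-≟-sym i j with i ≟ j
... | yes refl = sym (dec-true (i ≟ i) refl)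
... | no i≢j   = sym (dec-false (j ≟ i) (i≢j ∘ sym))

does-≟⇒≡ : ∀ {c} (i j : Fin c) → does (i ≟ j) ≡ true → i ≡ j
does-≟⇒≡ i j h with i ≟ j | h
... | yes i≡j | _ = i≡j
... | no _    | ()

sum-𝟙-∧-≟ : ∀ {c} (b : Bool) (x : Fin c) → sum (λ i → 𝟙 (b ∧ does (x ≟ i))) ≡ 𝟙 b
sum-𝟙-∧-≟ b x = begin
  sum (λ i → 𝟙 (b ∧ does (x ≟ i))) ≡⟨ sum-single _ x vanish ⟩
  𝟙 (b ∧ does (x ≟ x))             ≡⟨ cong (λ t → 𝟙 (b ∧ t)) (dec-true (x ≟ x) refl) ⟩
  𝟙 (b ∧ true)                     ≡⟨ cong 𝟙 (∧-identityʳ b) ⟩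
  𝟙 b                              ∎
  where
  open ≡-Reasoning
  vanish : ∀ i → i ≢ x → 𝟙 (b ∧ does (x ≟ i)) ≡ 0
  vanish i i≢x rewrite dec-false (x ≟ i) (i≢x ∘ sym) | ∧-zeroʳ b = refl

module _ {n} (G : Graph n) (S : Subset n) where

  Colouring : ℕ → Set
  Colouring c = Fin n → Fin c

  colourClass : ∀ {c} → Colouring c → Fin c → Subset n
  colourClass col i = tabulate λ v → v ∈ᵇ S ∧ does (col v ≟ i)

  degIn-colourClass : ∀ {c} (col : Colouring c) i u →
    degIn G (colourClass col i) u ≡ sum (λ v → 𝟙 (adj G u v ∧ v ∈ᵇ S ∧ does (col v ≟ i)))
  degIn-colourClass col i u = trans (degIn≡sum G (colourClass col i) u)
    (sum-cong-≗ λ v → cong (λ t → 𝟙 (adj G u v ∧ t)) (∈ᵇ-tabulate _ v))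

  sum-colourClasses : ∀ {c} (col : Colouring c) (b : Fin n → Bool) →
    sum (λ i → sum (λ v → 𝟙 (b v ∧ v ∈ᵇ colourClass col i))) ≡ sum (λ v → 𝟙 (b v ∧ v ∈ᵇ S))
  sum-colourClasses {c} col b =
    trans (∑-comm λ i v → 𝟙 (b v ∧ v ∈ᵇ colourClass col i)) (sum-cong-≗ inOneClass)
    where
    open ≡-Reasoning
    inOneClass : ∀ v → sum (λ i → 𝟙 (b v ∧ v ∈ᵇ colourClass col i)) ≡ 𝟙 (b v ∧ v ∈ᵇ S)
    inOneClass v = begin
      sum {c} (λ i → 𝟙 (b v ∧ v ∈ᵇ colourClass col i))
        ≡⟨ sum-cong-≗ (λ i → cong (λ t → 𝟙 (b v ∧ t)) (∈ᵇ-tabulate (λ u → u ∈ᵇ S ∧ does (col u ≟ i)) v)) ⟩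
      sum {c} (λ i → 𝟙 (b v ∧ v ∈ᵇ S ∧ does (col v ≟ i)))
        ≡⟨ sum-cong-≗ (λ i → cong 𝟙 (∧-assoc (b v) (v ∈ᵇ S) (does (col v ≟ i)))) ⟨
      sum {c} (λ i → 𝟙 ((b v ∧ v ∈ᵇ S) ∧ does (col v ≟ i)))
        ≡⟨ sum-𝟙-∧-≟ (b v ∧ v ∈ᵇ S) (col v) ⟩
      𝟙 (b v ∧ v ∈ᵇ S) ∎

  ∣∣-colourClasses : ∀ {c} (col : Colouring c) → sum (λ i → ∣ colourClass col i ∣) ≡ ∣ S ∣
  ∣∣-colourClasses col = begin
    sum (λ i → ∣ colourClass col i ∣)                       ≡⟨ sum-cong-≗ (∣∣≡sum ∘ colourClass col) ⟩
    sum (λ i → sum (λ v → 𝟙 (v ∈ᵇ colourClass col i))) ≡⟨ sum-colourClasses col (const true) ⟩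
    sum (λ v → 𝟙 (v ∈ᵇ S))                               ≡⟨ ∣∣≡sum S ⟨
    ∣ S ∣                                                  ∎
    where open ≡-Reasoning

  degIn-colourClasses : ∀ {c} (col : Colouring c) w →
                        sum (λ i → degIn G (colourClass col i) w) ≡ degIn G S w
  degIn-colourClasses col w = begin
    sum (λ i → degIn G (colourClass col i) w)                     ≡⟨ sum-cong-≗ (λ i → degIn≡sum G (colourClass col i) w) ⟩
    sum (λ i → sum (λ v → 𝟙 (adj G w v ∧ v ∈ᵇ colourClass col i))) ≡⟨ sum-colourClasses col (adj G w) ⟩
    sum (λ v → 𝟙 (adj G w v ∧ v ∈ᵇ S))                             ≡⟨ degIn≡sum G S w ⟨
    degIn G S w                                                      ∎
    where open ≡-Reasoning

  monochromatic : ∀ {c} → Colouring c → Fin n → Fin n → ℕ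
  monochromatic col u v = 𝟙 (adj G u v ∧ u ∈ᵇ S ∧ v ∈ᵇ S ∧ does (col v ≟ col u))

  ownClassDegree : ∀ {c} → Colouring c → Fin n → ℕ
  ownClassDegree col u = sum (monochromatic col u)

  monochromaticPairs : ∀ {c} → Colouring c → ℕ
  monochromaticPairs col = sum (ownClassDegree col)

  monochromatic-sym : ∀ {c} (col : Colouring c) u v → monochromatic col u v ≡ monochromatic col v u
  monochromatic-sym col u v rewrite Graph.sym G u v | does-≟-sym (col v) (col u)
    with u ∈ᵇ S | v ∈ᵇ S
  ... | true  | true  = refl
  ... | true  | false = refl
  ... | false | true  = refl
  ... | false | false = refl

  monochromatic-diagonal : ∀ {c} (col : Colouring c) w → monochromatic col w w ≡ 0
  monochromatic-diagonal col w rewrite irrefl G w = refl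

  ownClassDegree-∈ : ∀ {c} (col : Colouring c) u → u ∈ᵇ S ≡ true →
                     ownClassDegree col u ≡ degIn G (colourClass col (col u)) u
  ownClassDegree-∈ col u u∈S rewrite u∈S = sym (degIn-colourClass col (col u) u)

  ownClassDegree-∉ : ∀ {c} (col : Colouring c) {u} → u ∉ S → ownClassDegree col u ≡ 0
  ownClassDegree-∉ col {u} u∉S = trans (sum-cong-≗ vanish) (sum-replicate-zero n)
    where
    vanish : ∀ v → monochromatic col u v ≡ 0
    vanish v rewrite dec-false (u ∈? S) u∉S | ∧-zeroʳ (adj G u v) = refl

  ∈-of-ownClassDegree : ∀ {c} (col : Colouring c) {u k} → k < ownClassDegree col u → u ∈ S
  ∈-of-ownClassDegree col {u} {k} k<deg =
    decidable-stable (u ∈? S) λ u∉S → n≮0 (subst (k <_) (ownClassDegree-∉ col u∉S) k<deg)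

  recolour : ∀ {c} → Colouring c → Fin n → Fin c → Colouring c
  recolour col w j = updateAt col w (const j)

  recolour-agree : ∀ {c} (col : Colouring c) w j u v → u ≢ w → v ≢ w →
                   monochromatic (recolour col w j) u v ≡ monochromatic col u v
  recolour-agree col w j u v u≢w v≢w
    rewrite updateAt-minimal u w {const j} col u≢w | updateAt-minimal v w {const j} col v≢w = refl

  ownClassDegree-recolour : ∀ {c} (col : Colouring c) w j → w ∈ᵇ S ≡ true →
    ownClassDegree (recolour col w j) w ≡ degIn G (colourClass col j) w
  ownClassDegree-recolour {c} col w j w∈S = begin
    ownClassDegree col′ w
      ≡⟨ ownClassDegree-∈ col′ w w∈S ⟩
    degIn G (colourClass col′ (col′ w)) w
      ≡⟨ cong (λ i → degIn G (colourClass col′ i) w) (updateAt-updates w col) ⟩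
    degIn G (colourClass col′ j) w
      ≡⟨ degIn-colourClass col′ j w ⟩
    sum (λ v → 𝟙 (adj G w v ∧ v ∈ᵇ S ∧ does (col′ v ≟ j)))
      ≡⟨ sum-cong-≗ unchanged ⟩
    sum (λ v → 𝟙 (adj G w v ∧ v ∈ᵇ S ∧ does (col v ≟ j)))
      ≡⟨ degIn-colourClass col j w ⟨
    degIn G (colourClass col j) w ∎
    where
    open ≡-Reasoning
    col′ : Colouring c
    col′ = recolour col w j
    -- w is not its own neighbour, so its old colour never counts.
    unchanged : ∀ v → 𝟙 (adj G w v ∧ v ∈ᵇ S ∧ does (col′ v ≟ j))
                    ≡ 𝟙 (adj G w v ∧ v ∈ᵇ S ∧ does (col v ≟ j))
    unchanged v with v ≟ w
    ... | yes refl rewrite irrefl G v = refl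
    ... | no v≢w   rewrite updateAt-minimal v w {const j} col v≢w = refl

  recolour-improves : ∀ {c} (col : Colouring c) w j → w ∈ᵇ S ≡ true →
    degIn G (colourClass col j) w < ownClassDegree col w →
    monochromaticPairs (recolour col w j) < monochromaticPairs col
  recolour-improves {c} col w j w∈S fewer = <-of-exchange
    (double-sum-exchange (monochromatic col) (monochromatic col′) w (recolour-agree col w j)
      (λ u → monochromatic-sym col u w) (λ u → monochromatic-sym col′ u w)
      (trans (monochromatic-diagonal col w) (sym (monochromatic-diagonal col′ w))))
    (subst (_< ownClassDegree col w) (sym (ownClassDegree-recolour col w j w∈S)) fewer)
    where
    col′ : Colouring c
    col′ = recolour col w j

  classes-independent : ∀ {c} p (col : Colouring c) → (∀ u → ownClassDegree col u ≤ p) →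
                        ∀ i → IsKIndependent p G (colourClass col i)
  classes-independent p col sparse i u u∈class =
    subst (_≤ p) (trans (ownClassDegree-∈ col u u∈S) (cong (λ k → degIn G (colourClass col k) u) colu≡i))
          (sparse u)
    where
    member : (u ∈ᵇ S ∧ does (col u ≟ i)) ≡ true
    member = trans (sym (∈ᵇ-tabulate _ u)) (dec-true (u ∈? colourClass col i) u∈class)
    u∈S : u ∈ᵇ S ≡ true
    u∈S = ∧-conicalˡ _ _ member
    colu≡i : col u ≡ i
    colu≡i = does-≟⇒≡ (col u) i (∧-conicalʳ _ _ member)

  module _ {p q c} (q<c*[1+p] : q < c * suc p) (S-independent : IsKIndependent q G S) where

    classDegrees< : ∀ (col : Colouring c) {w} → w ∈ S →
                    sum (λ i → degIn G (colourClass col i) w) < c * suc p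
    classDegrees< col {w} w∈S =
      ≤-<-trans (≤-reflexive (degIn-colourClasses col w)) (≤-<-trans (S-independent w w∈S) q<c*[1+p])

    improve : ∀ (col : Colouring c) w → p < ownClassDegree col w →
              Σ (Colouring c) λ col′ → monochromaticPairs col′ < monochromaticPairs col
    improve col w p<deg =
      let w∈S      = ∈-of-ownClassDegree col p<deg
          (j , few) = pigeonhole p (λ i → degIn G (colourClass col i) w) (classDegrees< col w∈S)
      in recolour col w j , recolour-improves col w j (dec-true (w ∈? S) w∈S) (≤-<-trans few p<deg)

    locallyOptimal : Colouring c → Σ (Colouring c) λ col → ∀ u → ownClassDegree col u ≤ p
    locallyOptimal = descend monochromaticPairs step
      where
      step : ∀ col → (∀ u → ownClassDegree col u ≤ p)
                   ⊎ Σ (Colouring c) λ col′ → monochromaticPairs col′ < monochromaticPairs col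
      step col with all? (λ u → ownClassDegree col u ≤? p)
      ... | yes sparse = inj₁ sparse
      ... | no notSparse with (w , dense) ← ¬∀⟶∃¬ n _ (λ u → ownClassDegree col u ≤? p) notSparse =
        inj₂ (improve col w (≰⇒> dense))

  partition-bound : ∀ {p q} c → q < c * suc p → IsKIndependent q G S →
    ∀ {ap} → (∀ T → IsKIndependent p G T → ∣ T ∣ ≤ ap) → ∣ S ∣ ≤ c * ap
  partition-bound zero    ()
  partition-bound {p} (suc c) q<c*[1+p] S-independent {ap} α-max
    with (col , sparse) ← locallyOptimal {c = suc c} q<c*[1+p] S-independent (const zero) = begin
    ∣ S ∣
      ≡⟨ ∣∣-colourClasses col ⟨
    sum (λ i → ∣ colourClass col i ∣)
      ≤⟨ sum-mono-≤ (λ i → α-max (colourClass col i) (classes-independent p col sparse i)) ⟩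
    sum {suc c} (const ap)
      ≡⟨ sum-const (suc c) ap ⟩
    suc c * ap ∎
    where open ≤-Reasoning

n<⌈1+n/1+m⌉*[1+m] : ∀ n m → n < ceilDiv (suc n) m * suc m
n<⌈1+n/1+m⌉*[1+m] n m = +-cancelˡ-< m _ _ (begin-strict
  m + n                                          <⟨ ≤-refl ⟩
  suc (m + n)                                    ≡⟨ cong suc (+-comm m n) ⟩
  suc n + m                                      ≡⟨ m≡m%n+[m/n]*n (suc n + m) (suc m) ⟩
  (suc n + m) % suc m + ceilDiv (suc n) m * suc m ≤⟨ +-monoˡ-≤ _ (≤-pred (m%n<n (suc n + m) (suc m))) ⟩
  m + ceilDiv (suc n) m * suc m                  ∎)
  where open ≤-Reasoning

theorem7 : ∀ {n : ℕ} (G : Graph n) (p q : ℕ) → p ≤ q →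
    ∀ (aq ap : ℕ) → IsAlpha q G aq → IsAlpha p G ap →
    aq ≤ ceilDiv (suc q) p * ap
theorem7 G p q _ aq ap ((S , S-independent , ∣S∣≡aq) , _) (_ , α-max) =
  subst (_≤ ceilDiv (suc q) p * ap) ∣S∣≡aq
    (partition-bound G S (ceilDiv (suc q) p) (n<⌈1+n/1+m⌉*[1+m] q p) S-independent α-max)
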